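{- Let $\mathcal D$ be a minimal QPL derivation, $a$ a node of $\mathcal D$ and $b$ a major parent of $a$. If the rule $R(b)$ at $b$ is an introduction rule, then the rule $R(a)$ at $a$ is an introduction rule as well.
   Context: Language: first-order, without equality and function symbols of positive arity; terms are variables and constants; formulas built from $\top,\bot$, atoms $R(t_1,\dots,t_j)$ by $\land,\lor,\to,\forall x,\exists x$; $A(t)$ denotes substitution of a substitutable term $t$ for free $x$ in $A(x)$. QPL is the Hilbert-style calculus with the following rules (premises / conclusion). Introduction rules: $\top$I: axiom $\top$; $\land$I: $A,B/A\land B$; $\lor$I: $A/A\lor B$ and $B/A\lor B$; $\to$I: $B/A\to B$ and the axiom $A\to A$; $\forall$I: $A/\forall xA$ where $x$ is not free in $A$; $\exists$I: $A(t)/\exists xA(x)$. Elimination rules: $\land$E: $A\land B/A$ and $A\land B/B$; $\lor$E: $A\lor A/A$; $\to$E: $A,\ A\to B/B$; $\bot$E: $\bot/A$; $\forall$E: $\forall xA(x)/A(t)$; $\exists$E: $\exists xA/A$ where $x$ is not free in $A$. A derivation is a finite upward-growing tree with formula labels; leaves are axiom nodes or hypothesis nodes; each nonleaf node $a$ carries a rule instance $R(a)$ whose premises are the labels of its parents and whose conclusion is the label of $a$. Hypothesis-node labels are the hypotheses, the root label the conclusion. $\mathcal D$ is minimal if there is no derivation with the same conclusion and fewer nodes all of whose hypotheses are hypotheses of $\mathcal D$. In the rule $A, A\to B/B$ the premise $A$ is minor and $A\to B$ major. A parent $b$ of a node $a$ is the minor parent of $a$ if $R(a)$ is $\to$E and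 the label of $b$ is the minor premise; otherwise $b$ is a major parent of $a$. -}

module Defs where

open import Data.Nat using (ℕ; zero; suc; _+_; _<_; _≡ᵇ_)
open import Data.Bool using (Bool; true; false; not; _∧_; _∨_; if_then_else_; T)
open import Data.List using (List; []; _∷_; map; _++_)
open import Data.List.Membership.Propositional using (_∈_)
open import Data.Empty using (⊥)
open import Data.Unit using (⊤)
open import Relation.Binary.PropositionalEquality using (_≡_)

-- Syntax: variables and constants are indexed by ℕ; a relation symbol is
-- a name (ℕ) applied to a list of terms (its arity is the list length).

data Term : Set where
  var : ℕ → Term
  con : ℕ → Term

infixr 6 _∧'_
infixr 5 _∨'_
infixr 4 _⇒_

data Formula : Set where
  ⊤' ⊥' : Formula
  atom  : ℕ → List Term → Formula
  _∧'_ _∨'_ _⇒_ : Formula → Formula → Formula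
  ∀' ∃' : ℕ → Formula → Formula

occT : ℕ → Term → Bool
occT x (var y) = x ≡ᵇ y
occT x (con c) = false

occTs : ℕ → List Term → Bool
occTs x [] = false
occTs x (t ∷ ts) = occT x t ∨ occTs x ts

free : ℕ → Formula → Bool
free x ⊤' = false
free x ⊥' = false
free x (atom R ts) = occTs x ts
free x (A ∧' B) = free x A ∨ free x B
free x (A ∨' B) = free x A ∨ free x B
free x (A ⇒ B) = free x A ∨ free x B
free x (∀' y A) = not (x ≡ᵇ y) ∧ free x A
free x (∃' y A) = not (x ≡ᵇ y) ∧ free x A

-- replace free occurrences of x by t (no renaming)
subT : ℕ → Term → Term → Term
subT x t (var y) = if x ≡ᵇ y then t else var y
subT x t (con c) = con c

sub : ℕ → Term → Formula → Formula
sub x t ⊤' = ⊤'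
sub x t ⊥' = ⊥'
sub x t (atom R ts) = atom R (map (subT x t) ts)
sub x t (A ∧' B) = sub x t A ∧' sub x t B
sub x t (A ∨' B) = sub x t A ∨' sub x t B
sub x t (A ⇒ B) = sub x t A ⇒ sub x t B
sub x t (∀' y A) = if x ≡ᵇ y then ∀' y A else ∀' y (sub x t A)
sub x t (∃' y A) = if x ≡ᵇ y then ∃' y A else ∃' y (sub x t A)

substitutable : ℕ → Term → Formula → Bool
substitutable x t ⊤' = true
substitutable x t ⊥' = true
substitutable x t (atom R ts) = true
substitutable x t (A ∧' B) = substitutable x t A ∧ substitutable x t B
substitutable x t (A ∨' B) = substitutable x t A ∧ substitutable x t B
substitutable x t (A ⇒ B) = substitutable x t A ∧ substitutable x t B
substitutable x t (∀' y A) =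
  not (free x (∀' y A)) ∨ (not (occT y t) ∧ substitutable x t A)
substitutable x t (∃' y A) =
  not (free x (∃' y A)) ∨ (not (occT y t) ∧ substitutable x t A)

-- Rule instances of QPL: Rule Γ C = instance with premises Γ (in order)
-- and conclusion C.  Axioms are rules with no premises.

data Rule : List Formula → Formula → Set where
  ⊤I   : Rule [] ⊤'
  ∧I   : ∀ {A B} → Rule (A ∷ B ∷ []) (A ∧' B)
  ∨I₁  : ∀ {A B} → Rule (A ∷ []) (A ∨' B)
  ∨I₂  : ∀ {A B} → Rule (B ∷ []) (A ∨' B)
  ⇒I   : ∀ {A B} → Rule (B ∷ []) (A ⇒ B)
  ⇒Iax : ∀ {A} → Rule [] (A ⇒ A)
  ∀I   : ∀ {A} x → T (not (free x A)) → Rule (A ∷ []) (∀' x A)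
  ∃I   : ∀ {A} x t → T (substitutable x t A) → Rule (sub x t A ∷ []) (∃' x A)
  ∧E₁  : ∀ {A B} → Rule ((A ∧' B) ∷ []) A
  ∧E₂  : ∀ {A B} → Rule ((A ∧' B) ∷ []) B
  ∨E   : ∀ {A} → Rule ((A ∨' A) ∷ []) A
  ⇒E   : ∀ {A B} → Rule (A ∷ (A ⇒ B) ∷ []) B
  ⊥E   : ∀ {A} → Rule (⊥' ∷ []) A
  ∀E   : ∀ {A} x t → T (substitutable x t A) → Rule (∀' x A ∷ []) (sub x t A)
  ∃E   : ∀ {A} x → T (not (free x A)) → Rule (∃' x A ∷ []) A

isIntro : ∀ {Γ C} → Rule Γ C → Bool
isIntro ⊤I = true
isIntro ∧I = true
isIntro ∨I₁ = true
isIntro ∨I₂ = true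
isIntro ⇒I = true
isIntro ⇒Iax = true
isIntro (∀I _ _) = true
isIntro (∃I _ _ _) = true
isIntro _ = false

IsIntroRule : ∀ {Γ C} → Rule Γ C → Set
IsIntroRule r = T (isIntro r)

-- A leaf is either a hypothesis
-- node (hyp) or an axiom node (node with a zero-premise rule); the parents
-- of a nonleaf node are listed in the order of the premises of its rule.

mutual
  data Deriv : Formula → Set where
    hyp  : (A : Formula) → Deriv A
    node : ∀ {Γ C} → Rule Γ C → Derivs Γ → Deriv C

  data Derivs : List Formula → Set where
    []  : Derivs []
    _∷_ : ∀ {B Γ} → Deriv B → Derivs Γ → Derivs (B ∷ Γ)

mutual
  size : ∀ {C} → Deriv C → ℕ
  size (hyp _) = 1
  size (node r ds) = suc (sizes ds)

  sizes : ∀ {Γ} → Derivs Γ → ℕ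
  sizes [] = 0
  sizes (d ∷ ds) = size d + sizes ds

mutual
  hyps : ∀ {C} → Deriv C → List Formula
  hyps (hyp A) = A ∷ []
  hyps (node r ds) = hypss ds

  hypss : ∀ {Γ} → Derivs Γ → List Formula
  hypss [] = []
  hypss (d ∷ ds) = hyps d ++ hypss ds

Minimal : ∀ {C} → Deriv C → Set
Minimal {C} D = (D' : Deriv C) → size D' < size D →
  (∀ {H} → H ∈ hyps D' → H ∈ hyps D) → ⊥

data _∈ᶜ_ : ∀ {B Γ} → Deriv B → Derivs Γ → Set where
  hd : ∀ {B Γ} {d : Deriv B} {ds : Derivs Γ} → d ∈ᶜ (d ∷ ds)
  tl : ∀ {B B' Γ} {d : Deriv B} {d' : Deriv B'} {ds : Derivs Γ} →
       d ∈ᶜ ds → d ∈ᶜ (d' ∷ ds)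

index : ∀ {B Γ} {d : Deriv B} {ds : Derivs Γ} → d ∈ᶜ ds → ℕ
index hd = 0
index (tl p) = suc (index p)

-- E ≼ D : (a proof of this is) a node of D, whose subtree is E
data _≼_ : ∀ {B C} → Deriv B → Deriv C → Set where
  here  : ∀ {C} {D : Deriv C} → D ≼ D
  under : ∀ {B B' Γ C} {E : Deriv B} {d : Deriv B'} {r : Rule Γ C}
            {ds : Derivs Γ} → E ≼ d → d ∈ᶜ ds → E ≼ node r ds

-- b is the minor parent: the rule is ⇒E and b is at the minor premise A
isMinorPos : ∀ {Γ C} → Rule Γ C → ℕ → Bool
isMinorPos ⇒E zero = true
isMinorPos _ _ = false

data Major : ∀ {B C} → Deriv B → Deriv C → Set where
  major : ∀ {B Γ C} {b : Deriv B} {r : Rule Γ C} {ds : Derivs Γ}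
          (p : b ∈ᶜ ds) → T (not (isMinorPos r (index p))) → Major b (node r ds)

IntroNode : ∀ {C} → Deriv C → Set
IntroNode (hyp _) = ⊥
IntroNode (node r _) = IsIntroRule r

-- An elimination whose major premise is inferred by an introduction is a
-- detour: its conclusion already occurs strictly above it (a premise of the
-- introduction, or the minor premise when ⇒E follows the axiom A ⇒ A; for ∀E
-- and ∃E the side condition makes the substitution trivial).  Grafting that
-- subderivation in place of the node shrinks the derivation without adding
-- hypotheses, which minimality forbids.

module Submission where

open import Defs
open import Data.Nat using (_<_; _≤_; _≡ᵇ_; s≤s)
open import Data.Nat.Properties using (≤-refl; ≤-trans; m≤m+n; m≤n+m; n≤1+n; +-monoˡ-<; +-monoʳ-<)
open import Data.Bool using (true; false; not; T)
open import Data.Bool.Properties using (∨-conicalˡ; ∨-conicalʳ; T-not-≡)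
open import Data.List using ([]; _∷_; map)
open import Data.List.Relation.Binary.Subset.Propositional using (_⊆_)
open import Data.List.Relation.Binary.Subset.Propositional.Properties
  using (⊆-trans; xs⊆xs++ys; xs⊆ys++xs; ++⁺ˡ; ++⁺ʳ)
open import Data.Sum using (_⊎_; inj₁; inj₂)
open import Data.Unit using (tt)
open import Data.Empty using (⊥-elim)
open import Function using (id)
open import Function.Bundles using (Equivalence)
open import Relation.Nullary using (¬_)
open import Relation.Binary.PropositionalEquality using (_≡_; refl; sym; cong; cong₂)

subTs-fresh : ∀ x t ts → occTs x ts ≡ false → map (subT x t) ts ≡ ts
subTs-fresh x t [] _ = refl
subTs-fresh x t (con c ∷ ts) fresh = cong (con c ∷_) (subTs-fresh x t ts fresh)
subTs-fresh x t (var y ∷ ts) fresh with x ≡ᵇ y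
... | false = cong (var y ∷_) (subTs-fresh x t ts fresh)

sub-fresh : ∀ x t A → free x A ≡ false → sub x t A ≡ A
sub-fresh x t ⊤' _ = refl
sub-fresh x t ⊥' _ = refl
sub-fresh x t (atom R ts) fresh = cong (atom R) (subTs-fresh x t ts fresh)
sub-fresh x t (A ∧' B) fresh =
  cong₂ _∧'_ (sub-fresh x t A (∨-conicalˡ _ _ fresh)) (sub-fresh x t B (∨-conicalʳ _ _ fresh))
sub-fresh x t (A ∨' B) fresh =
  cong₂ _∨'_ (sub-fresh x t A (∨-conicalˡ _ _ fresh)) (sub-fresh x t B (∨-conicalʳ _ _ fresh))
sub-fresh x t (A ⇒ B) fresh =
  cong₂ _⇒_ (sub-fresh x t A (∨-conicalˡ _ _ fresh)) (sub-fresh x t B (∨-conicalʳ _ _ fresh))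
sub-fresh x t (∀' y A) fresh with x ≡ᵇ y
... | true = refl
... | false = cong (∀' y) (sub-fresh x t A fresh)
sub-fresh x t (∃' y A) fresh with x ≡ᵇ y
... | true = refl
... | false = cong (∃' y) (sub-fresh x t A fresh)

data _≺_ {B C} (E : Deriv B) : Deriv C → Set where
  above : ∀ {B' Γ} {d : Deriv B'} {r : Rule Γ C} {ds : Derivs Γ} →
          E ≼ d → d ∈ᶜ ds → E ≺ node r ds

size-∈ᶜ : ∀ {B Γ} {d : Deriv B} {ds : Derivs Γ} → d ∈ᶜ ds → size d ≤ sizes ds
size-∈ᶜ (hd {d = d} {ds = ds}) = m≤m+n (size d) (sizes ds)
size-∈ᶜ (tl {d' = d'} p) = ≤-trans (size-∈ᶜ p) (m≤n+m _ (size d'))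

size-≼ : ∀ {B C} {E : Deriv B} {D : Deriv C} → E ≼ D → size E ≤ size D
size-≼ here = ≤-refl
size-≼ (under q p) = ≤-trans (size-≼ q) (≤-trans (size-∈ᶜ p) (n≤1+n _))

size-≺ : ∀ {B C} {E : Deriv B} {D : Deriv C} → E ≺ D → size E < size D
size-≺ (above q p) = s≤s (≤-trans (size-≼ q) (size-∈ᶜ p))

hyps-∈ᶜ : ∀ {B Γ} {d : Deriv B} {ds : Derivs Γ} → d ∈ᶜ ds → hyps d ⊆ hypss ds
hyps-∈ᶜ (hd {d = d} {ds = ds}) = xs⊆xs++ys (hyps d) (hypss ds)
hyps-∈ᶜ (tl {d' = d'} p) = ⊆-trans (hyps-∈ᶜ p) (xs⊆ys++xs _ (hyps d'))

hyps-≼ : ∀ {B C} {E : Deriv B} {D : Deriv C} → E ≼ D → hyps E ⊆ hyps D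
hyps-≼ here = id
hyps-≼ (under q p) = ⊆-trans (hyps-≼ q) (hyps-∈ᶜ p)

hyps-≺ : ∀ {B C} {E : Deriv B} {D : Deriv C} → E ≺ D → hyps E ⊆ hyps D
hyps-≺ (above q p) = ⊆-trans (hyps-≼ q) (hyps-∈ᶜ p)

mutual
  replace : ∀ {A C} {a : Deriv A} {D : Deriv C} → a ≼ D → Deriv A → Deriv C
  replace here e = e
  replace (under {r = r} q p) e = node r (replaceᶜ p (replace q e))

  replaceᶜ : ∀ {B Γ} {d : Deriv B} {ds : Derivs Γ} → d ∈ᶜ ds → Deriv B → Derivs Γ
  replaceᶜ (hd {ds = ds}) e = e ∷ ds
  replaceᶜ (tl {d' = d'} p) e = d' ∷ replaceᶜ p e

size-replaceᶜ : ∀ {B Γ} {d : Deriv B} {ds : Derivs Γ} (p : d ∈ᶜ ds) {e : Deriv B} →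
  size e < size d → sizes (replaceᶜ p e) < sizes ds
size-replaceᶜ (hd {ds = ds}) lt = +-monoˡ-< (sizes ds) lt
size-replaceᶜ (tl {d' = d'} p) lt = +-monoʳ-< (size d') (size-replaceᶜ p lt)

size-replace : ∀ {A C} {a : Deriv A} {D : Deriv C} (q : a ≼ D) {e : Deriv A} →
  size e < size a → size (replace q e) < size D
size-replace here lt = lt
size-replace (under q p) lt = s≤s (size-replaceᶜ p (size-replace q lt))

hyps-replaceᶜ : ∀ {B Γ} {d : Deriv B} {ds : Derivs Γ} (p : d ∈ᶜ ds) {e : Deriv B} →
  hyps e ⊆ hyps d → hypss (replaceᶜ p e) ⊆ hypss ds
hyps-replaceᶜ (hd {ds = ds}) sub = ++⁺ˡ (hypss ds) sub
hyps-replaceᶜ (tl {d' = d'} p) sub = ++⁺ʳ (hyps d') (hyps-replaceᶜ p sub)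

hyps-replace : ∀ {A C} {a : Deriv A} {D : Deriv C} (q : a ≼ D) {e : Deriv A} →
  hyps e ⊆ hyps a → hyps (replace q e) ⊆ hyps D
hyps-replace here sub = sub
hyps-replace (under q p) sub = hyps-replaceᶜ p (hyps-replace q sub)

≼-minimal : ∀ {A C} {a : Deriv A} {D : Deriv C} → Minimal D → a ≼ D → Minimal a
≼-minimal min q e lt sub = min (replace q e) (size-replace q lt) (hyps-replace q sub)

data Redundant {A} (a : Deriv A) : Set where
  redundant : ∀ {A'} {e : Deriv A'} → A' ≡ A → e ≺ a → Redundant a

minimal⇒¬redundant : ∀ {A} {a : Deriv A} → Minimal a → ¬ Redundant a
minimal⇒¬redundant min (redundant refl e≺a) = min _ (size-≺ e≺a) (hyps-≺ e≺a)

-- A view of IsIntroRule: matching it against a premise of fixed shape never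
-- has to unify that shape with the conclusion sub x t A of ∀E.
data IntroRule : ∀ {Γ C} → Rule Γ C → Set where
  ⊤I   : IntroRule ⊤I
  ∧I   : ∀ {A B} → IntroRule (∧I {A} {B})
  ∨I₁  : ∀ {A B} → IntroRule (∨I₁ {A} {B})
  ∨I₂  : ∀ {A B} → IntroRule (∨I₂ {A} {B})
  ⇒I   : ∀ {A B} → IntroRule (⇒I {A} {B})
  ⇒Iax : ∀ {A} → IntroRule (⇒Iax {A})
  ∀I   : ∀ {A} x nf → IntroRule (∀I {A} x nf)
  ∃I   : ∀ {A} x t s → IntroRule (∃I {A} x t s)

introRule : ∀ {Γ C} (r : Rule Γ C) → IsIntroRule r → IntroRule r
introRule ⊤I _ = ⊤I
introRule ∧I _ = ∧I
introRule ∨I₁ _ = ∨I₁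
introRule ∨I₂ _ = ∨I₂
introRule ⇒I _ = ⇒I
introRule ⇒Iax _ = ⇒Iax
introRule (∀I x nf) _ = ∀I x nf
introRule (∃I x t s) _ = ∃I x t s
introRule ∧E₁ ()
introRule ∧E₂ ()
introRule ∨E ()
introRule ⇒E ()
introRule ⊥E ()
introRule (∀E _ _ _) ()
introRule (∃E _ _) ()

intro⊎redundant : ∀ {Γ A Δ B} (r : Rule Γ A) {ds : Derivs Γ} {r' : Rule Δ B} {ds' : Derivs Δ}
  (p : node r' ds' ∈ᶜ ds) → T (not (isMinorPos r (index p))) → IntroRule r' →
  IsIntroRule r ⊎ Redundant (node r ds)
intro⊎redundant ⊤I _ _ _ = inj₁ tt
intro⊎redundant ∧I _ _ _ = inj₁ tt
intro⊎redundant ∨I₁ _ _ _ = inj₁ tt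
intro⊎redundant ∨I₂ _ _ _ = inj₁ tt
intro⊎redundant ⇒I _ _ _ = inj₁ tt
intro⊎redundant ⇒Iax _ _ _ = inj₁ tt
intro⊎redundant (∀I _ _) _ _ _ = inj₁ tt
intro⊎redundant (∃I _ _ _) _ _ _ = inj₁ tt
intro⊎redundant ∧E₁ {ds' = _ ∷ _ ∷ []} hd _ ∧I = inj₂ (redundant refl (above (under here hd) hd))
intro⊎redundant ∧E₂ {ds' = _ ∷ _ ∷ []} hd _ ∧I = inj₂ (redundant refl (above (under here (tl hd)) hd))
intro⊎redundant ∨E {ds' = _ ∷ []} hd _ ∨I₁ = inj₂ (redundant refl (above (under here hd) hd))
intro⊎redundant ∨E {ds' = _ ∷ []} hd _ ∨I₂ = inj₂ (redundant refl (above (under here hd) hd))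
intro⊎redundant ⇒E {ds = _ ∷ _} {ds' = _ ∷ []} (tl hd) _ ⇒I =
  inj₂ (redundant refl (above (under here hd) (tl hd)))
intro⊎redundant ⇒E {ds = _ ∷ _} (tl hd) _ ⇒Iax = inj₂ (redundant refl (above here hd))
intro⊎redundant ⊥E hd _ ()
intro⊎redundant (∀E x t _) {ds' = _ ∷ []} hd _ (∀I .x nf) =
  inj₂ (redundant (sym (sub-fresh x t _ (Equivalence.to T-not-≡ nf))) (above (under here hd) hd))
intro⊎redundant (∃E x nf) {ds' = _ ∷ []} hd _ (∃I .x t _) =
  inj₂ (redundant (sub-fresh x t _ (Equivalence.to T-not-≡ nf)) (above (under here hd) hd))

lemma6p11 : ∀ {C} (D : Deriv C) → Minimal D →
    ∀ {A B} (a : Deriv A) → a ≼ D → (b : Deriv B) → Major b a →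
    IntroNode b → IntroNode a
lemma6p11 D min (node r ds) a≼D (node r' ds') (major p nm) r'-intro
  with intro⊎redundant r p nm (introRule r' r'-intro)
... | inj₁ r-intro = r-intro
... | inj₂ red = ⊥-elim (minimal⇒¬redundant (≼-minimal min a≼D) red)
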